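{- Let $A$ be a set of atoms, let $P$ be an $A$-program and let $a\in\mathrm{At}(P)\setminus A$. Then $A\cup\{a\}$ is an $A$-based stable model of $P$ if and only if $F(a)=0$, $G(a)>0$, and there is a program $Q\in\mathcal{P}(A)$ such that $H(r,a)>0$ for every rule $r\in Q$.
   Context: A logic program is a finite set of rules $r$ of the form $a \leftarrow b_1,\ldots,b_s,\mathbf{not}(c_1),\ldots,\mathbf{not}(c_t)$ ($a,b_i,c_j$ propositional atoms, no repeated atoms within $b^+(r)$ or within $b^-(r)$); $h(r)=a$, $b^+(r)=\{b_1,\ldots,b_s\}$, $b^-(r)=\{c_1,\ldots,c_t\}$; $\mathrm{At}(P)$ is the set of atoms of $P$; $horn(r)$ is the rule obtained from $r$ by deleting all negated atoms. For a set of atoms $M$, the reduct $P^M$ is obtained by deleting every rule $r$ with $b^-(r)\cap M\neq\emptyset$ and deleting negated atoms from the remaining rules; $LM(\cdot)$ is the least model of a Horn program; $M$ is a stable model of $P$ if $M=LM(P^M)$. $P(A)$ is the set of rules $r\in P$ with $b^-(r)\cap A=\emptyset$ and $b^+(r)\subseteq A$. A stable model $M$ of $P$ is $A$-based if $M=A\cup\{a\}$ with $a\in\mathrm{At}(P)\setminus A$ and $M\subseteq LM(P(A)^M)$. $P$ is an $A$-program if $b^+(r)\subseteq A$ and $b^-(r)\cap A=\emptyset$ for every $r\in P$. A Horn rule $r$ is proper if $h(r)\notin b^+(r)$. $R(A)$ is the set of all proper Horn rules whose atoms are in $A$, and $\mathcal{P}(A)$ is the set of all Horn programs $Q\subseteq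 R(A)$ with $LM(Q)=A$. For $a\in\mathrm{At}(P)\setminus A$: $F(a)=1$ if there is a rule $s\in P$ with $h(s)\notin A\cup\{a\}$ and $a\notin b^-(s)$, and $F(a)=0$ otherwise; $G(a)$ is the number of rules $s\in P$ with $h(s)=a$ and $a\notin b^-(s)$; for $r\in R(A)$, $H(r,a)=1$ if there is a rule $s\in P$ with $horn(s)=r$ and $a\notin b^-(s)$, and $H(r,a)=0$ otherwise. -}

module Defs where

open import Data.Nat using (ℕ; _≟_)
open import Data.Bool using (if_then_else_)
open import Data.List using (List; []; length; filter)
open import Data.List.Relation.Unary.All using (All)
open import Data.List.Relation.Unary.Any using (any?)
open import Data.List.Relation.Unary.Unique.Propositional using (Unique)
open import Data.List.Membership.Propositional using (_∈_; _∉_)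
open import Data.List.Membership.DecPropositional _≟_ using (_∈?_)
open import Data.List.Relation.Binary.Subset.Propositional using (_⊆_)
open import Data.List.Relation.Binary.Subset.DecPropositional _≟_ using (_⊆?_)
open import Data.Product using (Σ; ∃; _×_; _,_)
open import Data.Sum using (_⊎_)
open import Relation.Nullary using (¬_; Dec; yes; no; ¬?)
open import Relation.Nullary.Decidable using (_×-dec_; _⊎-dec_; does)
open import Relation.Binary.PropositionalEquality using (_≡_)
open import Function.Bundles using (_⇔_)

Atom : Set
Atom = ℕ

-- A rule  head ← pos, not(neg).  Bodies are given as lists; they denote sets.
record Rule : Set where
  constructor mkRule
  field
    head : Atom
    pos  : List Atom
    neg  : List Atom
open Rule public

WellFormed : Rule → Set
WellFormed r = Unique (pos r) × Unique (neg r)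

Program : Set
Program = List Rule

-- Rules are compared as the paper does: same head, same body sets.
SameRule : Rule → Rule → Set
SameRule r s = (head r ≡ head s) × ((pos r ⊆ pos s) × (pos s ⊆ pos r))
                 × ((neg r ⊆ neg s) × (neg s ⊆ neg r))

sameRule? : (r s : Rule) → Dec (SameRule r s)
sameRule? r s = (head r ≟ head s) ×-dec ((pos r ⊆? pos s) ×-dec (pos s ⊆? pos r))
                  ×-dec ((neg r ⊆? neg s) ×-dec (neg s ⊆? neg r))

horn : Rule → Rule
horn r = mkRule (head r) (pos r) []

AtomSet : Set₁
AtomSet = Atom → Set

_≐_ : AtomSet → AtomSet → Set
M ≐ N = ∀ x → M x ⇔ N x

_⊑_ : AtomSet → AtomSet → Set
M ⊑ N = ∀ x → M x → N x

RuleSet : Set₁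
RuleSet = Rule → Set

-- Least model of a Horn program (negative bodies are ignored; only applied
-- to Horn programs): the inductively generated set of derivable atoms.
data LM (Q : RuleSet) : Atom → Set where
  derive : ∀ r → Q r → All (LM Q) (pos r) → LM Q (head r)

reduct : RuleSet → AtomSet → RuleSet
reduct P M r′ = Σ Rule λ r → P r × (∀ c → c ∈ neg r → ¬ M c) × (r′ ≡ horn r)

StableModel : RuleSet → AtomSet → Set
StableModel P M = M ≐ LM (reduct P M)

At : Program → AtomSet
At P x = Σ Rule λ r → r ∈ P × ((x ≡ head r) ⊎ (x ∈ pos r) ⊎ (x ∈ neg r))

⟦_⟧ : List Atom → AtomSet
⟦ A ⟧ x = x ∈ A

_∪｛_｝ : List Atom → Atom → AtomSet
(A ∪｛ a ｝) x = (x ∈ A) ⊎ (x ≡ a)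

NegDisjoint : Rule → List Atom → Set
NegDisjoint r A = ∀ c → c ∈ neg r → c ∉ A

P⟨_⟩ : Program → List Atom → RuleSet
P⟨ P ⟩ A r = r ∈ P × NegDisjoint r A × (pos r ⊆ A)

ABasedStableModel : Program → List Atom → AtomSet → Set
ABasedStableModel P A M =
  StableModel (_∈ P) M ×
  (Σ Atom λ a → At P a × a ∉ A × (M ≐ (A ∪｛ a ｝))) ×
  (M ⊑ LM (reduct (P⟨ P ⟩ A) M))

AProgram : List Atom → Program → Set
AProgram A P = ∀ r → r ∈ P → (pos r ⊆ A) × NegDisjoint r A

IsHorn : Rule → Set
IsHorn r = neg r ≡ []

Proper : Rule → Set
Proper r = head r ∉ pos r

R : List Atom → Rule → Set
R A r = WellFormed r × IsHorn r × Proper r × (head r ∈ A) × (pos r ⊆ A)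

𝒫 : List Atom → Program → Set
𝒫 A Q = All (R A) Q × (LM (_∈ Q) ≐ ⟦ A ⟧)

F : Program → List Atom → Atom → ℕ
F P A a = if does (any? (λ s → ¬? ((head s ∈? A) ⊎-dec (head s ≟ a)) ×-dec ¬? (a ∈? neg s)) P)
          then 1 else 0

G : Program → Atom → ℕ
G P a = length (filter (λ s → (head s ≟ a) ×-dec ¬? (a ∈? neg s)) P)

H : Program → Rule → Atom → ℕ
H P r a = if does (any? (λ s → sameRule? (horn s) r ×-dec ¬? (a ∈? neg s)) P)
          then 1 else 0

-- In an A-program every positive body lies in A and every negative body misses
-- A, so for M = A ∪ {a} the reduct P^M consists of the Horn parts of the rules
-- s with a ∉ b⁻(s), all with bodies in A.  Then LM(P^M) ⊆ M says that no such
-- rule has its head outside A ∪ {a} (F(a) = 0); a ∈ LM(P^M), given A, says that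
-- one of them has head a (G(a) > 0); and A ⊆ LM(P^M) says that A is the least
-- model of a proper Horn program built from them (H > 0 on some Q ∈ 𝒫(A)),
-- since improper rules derive nothing new.  As P(A) = P, stability already
-- makes A ∪ {a} A-based.
module Submission where

open import Defs
open import Data.Nat using (_>_; _≟_; z≤n; s≤s)
open import Data.Bool using (if_then_else_)
open import Data.List using (List; []; _∷_; length; filter; map)
open import Data.List.Properties using (filter-some)
open import Data.List.Relation.Unary.All using (All; []; _∷_; lookup; tabulate)
open import Data.List.Relation.Unary.Any using (Any; here; there; any?)
open import Data.List.Relation.Unary.AllPairs using ([])
open import Data.List.Membership.Propositional using (_∈_; _∉_; find; lose)
open import Data.List.Membership.Propositional.Properties
  using (∈-filter⁻; ∈-map∘filter⁻; ∈-map∘filter⁺)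
open import Data.List.Membership.DecPropositional _≟_ using (_∈?_)
open import Data.List.Relation.Binary.Subset.Propositional using (_⊆_)
open import Data.Product using (Σ; ∃; _×_; _,_; proj₁; proj₂)
open import Data.Sum using (inj₁; inj₂; [_,_])
open import Data.Empty using (⊥-elim)
open import Level using (Level)
open import Relation.Unary using (Pred; Decidable)
open import Relation.Nullary using (¬_; Dec; yes; no; ¬?)
open import Relation.Nullary.Decidable using (_×-dec_; does)
open import Relation.Binary.PropositionalEquality using (_≡_; refl; sym; subst)
open import Function using (id)
open import Function.Bundles using (_⇔_; mk⇔; Equivalence)

private
  variable
    p : Level
    X : Set p

indicator-positive : (d : Dec X) → (if does d then 1 else 0) > 0 ⇔ X
indicator-positive (yes x) = mk⇔ (λ _ → x) (λ _ → s≤s z≤n)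
indicator-positive (no ¬x) = mk⇔ (λ ()) (λ x → ⊥-elim (¬x x))

indicator-zero : (d : Dec X) → (if does d then 1 else 0) ≡ 0 ⇔ (¬ X)
indicator-zero (yes x) = mk⇔ (λ ()) (λ ¬x → ⊥-elim (¬x x))
indicator-zero (no ¬x) = mk⇔ (λ _ → ¬x) (λ _ → refl)

length-filter-positive : {A : Set} {P : Pred A p} (P? : Decidable P) (xs : List A) →
                         length (filter P? xs) > 0 ⇔ Any P xs
length-filter-positive P? xs = mk⇔ nonempty⇒any (filter-some P?)
  where
  nonempty⇒any : length (filter P? xs) > 0 → Any _ xs
  nonempty⇒any _ with filter P? xs in eq
  ... | x ∷ _ = let x∈xs , px = ∈-filter⁻ P? (subst (x ∈_) (sym eq) (here refl))
                in lose x∈xs px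

sameRule-refl : ∀ r → SameRule r r
sameRule-refl r = refl , (id , id) , (id , id)

_≼_ : RuleSet → RuleSet → Set
Q ≼ Q′ = ∀ r → Q r → ∃ λ r′ → Q′ r′ × head r′ ≡ head r × pos r′ ⊆ pos r

module _ {Q Q′ : RuleSet} (Q≼Q′ : Q ≼ Q′) where
  mutual
    LM-mono : LM Q ⊑ LM Q′
    LM-mono _ (derive r r∈Q body) with Q≼Q′ r r∈Q
    ... | r′ , r′∈Q′ , refl , body′⊆body =
      derive r′ r′∈Q′ (tabulate λ x∈body′ → lookup (LM-mono-All body) (body′⊆body x∈body′))

    LM-mono-All : ∀ {xs} → All (LM Q) xs → All (LM Q′) xs
    LM-mono-All [] = []
    LM-mono-All (l ∷ ls) = LM-mono _ l ∷ LM-mono-All ls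

module AProgramAt (A : List Atom) (P : Program) (ap : AProgram A P) (a : Atom) where

  M : AtomSet
  M = A ∪｛ a ｝

  Pᴹ : RuleSet
  Pᴹ = reduct (_∈ P) M

  horn∈Pᴹ : ∀ {s} → s ∈ P → a ∉ neg s → Pᴹ (horn s)
  horn∈Pᴹ {s} s∈P a∉neg = s , s∈P , blocked-by-nothing , refl
    where
    blocked-by-nothing : ∀ c → c ∈ neg s → ¬ M c
    blocked-by-nothing c c∈neg (inj₁ c∈A) = proj₂ (ap s s∈P) c c∈neg c∈A
    blocked-by-nothing c c∈neg (inj₂ refl) = a∉neg c∈neg

  unblocked : ∀ s → (∀ c → c ∈ neg s → ¬ M c) → a ∉ neg s
  unblocked _ blocked a∈neg = blocked _ a∈neg (inj₂ refl)

  body-derivable : ⟦ A ⟧ ⊑ LM Pᴹ → ∀ {s} → s ∈ P → All (LM Pᴹ) (pos s)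
  body-derivable A⊑LM {s} s∈P = tabulate λ x∈pos → A⊑LM _ (proj₁ (ap s s∈P) x∈pos)

  Core : Rule → Set
  Core s = (head s ∈ A) × Proper s × (a ∉ neg s)

  core? : Decidable Core
  core? s = (head s ∈? A) ×-dec ¬? (head s ∈? pos s) ×-dec ¬? (a ∈? neg s)

  core : Program
  core = map horn (filter core? P)

  ∈-core⁺ : ∀ {s} → s ∈ P → Core s → horn s ∈ core
  ∈-core⁺ {s} s∈P core-s = ∈-map∘filter⁺ horn core? {xs = P} (s , s∈P , refl , core-s)

  ∈-core⁻ : ∀ {r} → r ∈ core → ∃ λ s → s ∈ P × r ≡ horn s × Core s
  ∈-core⁻ = ∈-map∘filter⁻ horn core? {xs = P}

  mutual
    LM-Pᴹ⇒LM-core : ∀ {x} → LM Pᴹ x → x ∈ A → LM (_∈ core) x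
    LM-Pᴹ⇒LM-core (derive .(horn s) (s , s∈P , blocked , refl) body) hs∈A
      with head s ∈? pos s
    -- an improper rule only rederives an atom of its own body
    ... | yes hs∈pos = lookup (LM-Pᴹ⇒LM-core-All body (proj₁ (ap s s∈P))) hs∈pos
    ... | no  hs∉pos = derive (horn s) horn-s∈core (LM-Pᴹ⇒LM-core-All body (proj₁ (ap s s∈P)))
      where
      horn-s∈core : horn s ∈ core
      horn-s∈core = ∈-core⁺ s∈P (hs∈A , hs∉pos , unblocked s blocked)

    LM-Pᴹ⇒LM-core-All : ∀ {xs} → All (LM Pᴹ) xs → xs ⊆ A → All (LM (_∈ core)) xs
    LM-Pᴹ⇒LM-core-All [] _ = []
    LM-Pᴹ⇒LM-core-All (l ∷ ls) xs⊆A =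
      LM-Pᴹ⇒LM-core l (xs⊆A (here refl)) ∷ LM-Pᴹ⇒LM-core-All ls (λ x∈xs → xs⊆A (there x∈xs))

  LM-core⊑A : LM (_∈ core) ⊑ ⟦ A ⟧
  LM-core⊑A _ (derive r r∈core _) with ∈-core⁻ r∈core
  ... | s , _ , refl , hs∈A , _ = hs∈A

  core⊆R : All WellFormed P → All (R A) core
  core⊆R wf = tabulate rule∈R
    where
    rule∈R : ∀ {r} → r ∈ core → R A r
    rule∈R r∈core with ∈-core⁻ r∈core
    ... | s , s∈P , refl , hs∈A , proper , _ =
      (proj₁ (lookup wf s∈P) , []) , refl , proper , hs∈A , proj₁ (ap s s∈P)

  core∈𝒫 : All WellFormed P → ⟦ A ⟧ ⊑ LM Pᴹ → 𝒫 A core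
  core∈𝒫 wf A⊑LM = core⊆R wf , λ x →
    mk⇔ (LM-core⊑A x) (λ x∈A → LM-Pᴹ⇒LM-core (A⊑LM x x∈A) x∈A)

  H-positive-on-core : All (λ r → H P r a > 0) core
  H-positive-on-core = tabulate H-positive
    where
    H-positive : ∀ {r} → r ∈ core → H P r a > 0
    H-positive r∈core with ∈-core⁻ r∈core
    ... | s , s∈P , refl , _ , _ , a∉neg =
      Equivalence.from (indicator-positive (any? _ P)) (lose s∈P (sameRule-refl (horn s) , a∉neg))

  H-positive⇒≼Pᴹ : ∀ {Q} → All (λ r → H P r a > 0) Q → (_∈ Q) ≼ Pᴹ
  H-positive⇒≼Pᴹ H>0 r r∈Q
    with find (Equivalence.to (indicator-positive (any? _ P)) (lookup H>0 r∈Q))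
  ... | s , s∈P , (same-head , (pos⊆ , _) , _) , a∉neg =
    horn s , horn∈Pᴹ s∈P a∉neg , same-head , pos⊆

  LM-Pᴹ-inversion : ∀ {x} → LM Pᴹ x → ∃ λ s → s ∈ P × a ∉ neg s × head s ≡ x
  LM-Pᴹ-inversion (derive .(horn s) (s , s∈P , blocked , refl) _) =
    s , s∈P , unblocked s blocked , refl

  stable⇒A⊑LM : StableModel (_∈ P) M → ⟦ A ⟧ ⊑ LM Pᴹ
  stable⇒A⊑LM st x x∈A = Equivalence.to (st x) (inj₁ x∈A)

  stable⇒F≡0 : StableModel (_∈ P) M → F P A a ≡ 0
  stable⇒F≡0 st = Equivalence.from (indicator-zero (any? _ P)) λ escaping →
    let s , s∈P , hs∉M , a∉neg = find escaping in
    hs∉M (Equivalence.from (st _)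
      (derive (horn s) (horn∈Pᴹ s∈P a∉neg) (body-derivable (stable⇒A⊑LM st) s∈P)))

  stable⇒G>0 : StableModel (_∈ P) M → G P a > 0
  stable⇒G>0 st =
    let s , s∈P , a∉neg , hs≡a = LM-Pᴹ-inversion (Equivalence.to (st a) (inj₂ refl)) in
    Equivalence.from (length-filter-positive _ P) (lose s∈P (hs≡a , a∉neg))

  H-positive⇒A⊑LM : ∀ {Q} → 𝒫 A Q → All (λ r → H P r a > 0) Q → ⟦ A ⟧ ⊑ LM Pᴹ
  H-positive⇒A⊑LM (_ , LM≐A) H>0 x x∈A =
    LM-mono (H-positive⇒≼Pᴹ H>0) x (Equivalence.from (LM≐A x) x∈A)

  G>0⇒a∈LM : ⟦ A ⟧ ⊑ LM Pᴹ → G P a > 0 → LM Pᴹ a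
  G>0⇒a∈LM A⊑LM G>0 with find (Equivalence.to (length-filter-positive _ P) G>0)
  ... | s , s∈P , hs≡a , a∉neg =
    subst (LM Pᴹ) hs≡a (derive (horn s) (horn∈Pᴹ s∈P a∉neg) (body-derivable A⊑LM s∈P))

  F≡0⇒LM⊑M : F P A a ≡ 0 → LM Pᴹ ⊑ M
  F≡0⇒LM⊑M F≡0 x l with LM-Pᴹ-inversion l
  ... | s , s∈P , a∉neg , refl with head s ∈? A | head s ≟ a
  ... | yes hs∈A | _        = inj₁ hs∈A
  ... | no _     | yes hs≡a = inj₂ hs≡a
  ... | no hs∉A  | no hs≢a  = ⊥-elim (Equivalence.to (indicator-zero (any? _ P)) F≡0
                                (lose s∈P ([ hs∉A , hs≢a ] , a∉neg)))

  Characterisation : Set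
  Characterisation = (F P A a ≡ 0) × (G P a > 0)
                     × (Σ Program λ Q → 𝒫 A Q × All (λ r → H P r a > 0) Q)

  stable⇒characterisation : All WellFormed P → StableModel (_∈ P) M → Characterisation
  stable⇒characterisation wf st =
    stable⇒F≡0 st , stable⇒G>0 st , core , core∈𝒫 wf (stable⇒A⊑LM st) , H-positive-on-core

  characterisation⇒stable : Characterisation → StableModel (_∈ P) M
  characterisation⇒stable (F≡0 , G>0 , Q , Q∈𝒫 , H>0) x = mk⇔ M⊑LM (F≡0⇒LM⊑M F≡0 x)
    where
    A⊑LM : ⟦ A ⟧ ⊑ LM Pᴹ
    A⊑LM = H-positive⇒A⊑LM Q∈𝒫 H>0

    M⊑LM : M x → LM Pᴹ x
    M⊑LM (inj₁ x∈A) = A⊑LM x x∈A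
    M⊑LM (inj₂ refl) = G>0⇒a∈LM A⊑LM G>0

  Pᴹ≼P⟨A⟩ᴹ : Pᴹ ≼ reduct (P⟨ P ⟩ A) M
  Pᴹ≼P⟨A⟩ᴹ r (s , s∈P , blocked , r≡horn-s) =
    r , (s , (s∈P , proj₂ (ap s s∈P) , proj₁ (ap s s∈P)) , blocked , r≡horn-s) , refl , id

  stable⇒A-based : At P a → a ∉ A → StableModel (_∈ P) M → ABasedStableModel P A M
  stable⇒A-based a∈At a∉A st =
    st , (a , a∈At , a∉A , λ _ → mk⇔ id id) ,
    λ x x∈M → LM-mono Pᴹ≼P⟨A⟩ᴹ x (Equivalence.to (st x) x∈M)

mainTheorem5 : (A : List Atom) (P : Program) → All WellFormed P → AProgram A P →
    (a : Atom) → At P a → a ∉ A →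
    (ABasedStableModel P A (A ∪｛ a ｝)
      ⇔ ((F P A a ≡ 0) × (G P a > 0)
          × (Σ Program λ Q → 𝒫 A Q × All (λ r → H P r a > 0) Q)))
mainTheorem5 A P wf ap a a∈At a∉A =
  mk⇔ (λ based → stable⇒characterisation wf (proj₁ based))
      (λ conditions → stable⇒A-based a∈At a∉A (characterisation⇒stable conditions))
  where open AProgramAt A P ap a
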